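{- (Working in $\mathsf{ZF}+\mathsf{DC}$.) Let $(D,\leq_D)$ and $(E,\leq_E)$ be directed sets, let $f\colon D\to E$, and define $\pi_f\colon D\to\mathcal{P}(E)$ by $\pi_f(d)=f(d)\uparrow_E$. (1) If $f$ is a Tukey map, then $\pi_f$ is a pre-Tukey map. (2) If $f$ is a convergent map, then $\pi_f$ is a pre-convergent map.
   Context: A directed set is a pre-ordered set in which every finite set has an upper bound. For $e\in E$, $e\uparrow_{E}=\{e'\in E: e\leq_E e'\}$ and $e\downarrow_{E}=\{e'\in E: e'\leq_E e\}$. $f\colon D\to E$ is a Tukey map if it maps $\leq_D$-unbounded subsets of $D$ to $\leq_E$-unbounded subsets of $E$, and a convergent map if it maps cofinal subsets of $D$ to cofinal subsets of $E$. A pre-Tukey map from $(D,\leq_D)$ to $(E,\leq_E)$ is a map $\pi\colon D\to\mathcal{P}(E)$ with $\pi(d)\neq\emptyset$ for all $d$ and such that for every $e\in E$ there is $d\in D$ with: for all $d'\in D$, if $\pi(d')\cap e\downarrow_E\neq\emptyset$ then $d'\leq_D d$. A pre-convergent map from $(D,\leq_D)$ to $(E,\leq_E)$ is a map $\sigma\colon D\to\mathcal{P}(E)$ with $\sigma(d)\neq\emptyset$ for all $d$ and such that for every $e\in E$ there is $d\in D$ with: for all $d'\in D$, if $d\leq_D d'$ then $\sigma(d')\subseteq e\uparrow_E$. -}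

module Defs where

open import Level using (0ℓ)
open import Data.Product using (Σ; ∃; _×_; _,_)
open import Data.List using (List)
open import Data.List.Relation.Unary.All using (All)
open import Data.Sum using (_⊎_)
open import Relation.Nullary using (¬_)
open import Relation.Unary using (Pred; _⊆_)
open import Relation.Binary.PropositionalEquality using (_≡_)

-- Classical metatheory (the paper works in ZF + DC, which includes LEM).
ExcludedMiddle : Set₁
ExcludedMiddle = (P : Set) → P ⊎ ¬ P

record DirectedSet : Set₁ where
  field
    Carrier  : Set
    _≤_      : Carrier → Carrier → Set
    ≤-refl   : ∀ {x} → x ≤ x
    ≤-trans  : ∀ {x y z} → x ≤ y → y ≤ z → x ≤ z
    directed : (xs : List Carrier) → ∃ λ u → All (λ x → x ≤ u) xs

open DirectedSet public using () renaming (Carrier to ∣_∣)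

module _ (E : DirectedSet) where
  open DirectedSet E

  _↑ : Carrier → Pred Carrier 0ℓ
  (e ↑) e' = e ≤ e'

  _↓ : Carrier → Pred Carrier 0ℓ
  (e ↓) e' = e' ≤ e

  Bounded : Pred Carrier 0ℓ → Set
  Bounded X = ∃ λ u → ∀ x → X x → x ≤ u

  Unbounded : Pred Carrier 0ℓ → Set
  Unbounded X = ¬ Bounded X

  Cofinal : Pred Carrier 0ℓ → Set
  Cofinal X = ∀ e → ∃ λ x → X x × e ≤ x

image : {A B : Set} → (A → B) → Pred A 0ℓ → Pred B 0ℓ
image f X b = ∃ λ a → X a × f a ≡ b

module _ (D E : DirectedSet) where
  private
    module D = DirectedSet D
    module E = DirectedSet E

  IsTukey : (∣ D ∣ → ∣ E ∣) → Set₁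
  IsTukey f = (X : Pred (∣ D ∣) 0ℓ) → Unbounded D X → Unbounded E (image f X)

  IsConvergent : (∣ D ∣ → ∣ E ∣) → Set₁
  IsConvergent f = (X : Pred (∣ D ∣) 0ℓ) → Cofinal D X → Cofinal E (image f X)

  Nonempty : Pred (∣ E ∣) 0ℓ → Set
  Nonempty S = ∃ λ e → S e

  IsPreTukey : (∣ D ∣ → Pred (∣ E ∣) 0ℓ) → Set
  IsPreTukey π =
    (∀ d → Nonempty (π d)) ×
    (∀ e → ∃ λ d → ∀ d' → (∃ λ e' → π d' e' × (_↓ E e) e') → d' D.≤ d)

  IsPreConvergent : (∣ D ∣ → Pred (∣ E ∣) 0ℓ) → Set
  IsPreConvergent σ =
    (∀ d → Nonempty (σ d)) ×
    (∀ e → ∃ λ d → ∀ d' → d D.≤ d' → σ d' ⊆ _↑ E e)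

  πf : (∣ D ∣ → ∣ E ∣) → ∣ D ∣ → Pred (∣ E ∣) 0ℓ
  πf f d = _↑ E (f d)

{-# OPTIONS --safe #-}
module Submission where

-- A Tukey map pulls bounded sets back to bounded sets, and a convergent map
-- pulls sets containing a tail back to sets containing a tail; both follow by
-- contraposition, which is where excluded middle enters.  For the sets e↓ and
-- e↑ these two facts are exactly the pre-Tukey and pre-convergent conditions
-- for π_f.

open import Defs
open import Level using (0ℓ)
open import Data.Product using (_×_; _,_; ∃)
open import Data.Sum using (inj₁; inj₂)
open import Data.Empty using (⊥-elim)
open import Relation.Nullary using (¬_)
open import Relation.Unary using (Pred; _⊆_; ∁; _⊢_)
open import Relation.Binary.PropositionalEquality using (refl)

¬¬-elim : ExcludedMiddle → {P : Set} → ¬ ¬ P → P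
¬¬-elim lem {P} ¬¬p with lem P
... | inj₁ p  = p
... | inj₂ ¬p = ⊥-elim (¬¬p ¬p)

image-preimage-⊆ : {A B : Set} (f : A → B) (Y : Pred B 0ℓ) → image f (f ⊢ Y) ⊆ Y
image-preimage-⊆ f Y (_ , Yfa , refl) = Yfa

module _ (D : DirectedSet) where
  open DirectedSet D

  Eventually : Pred Carrier 0ℓ → Set
  Eventually P = ∃ λ d → ∀ d' → d ≤ d' → P d'

  ↓-bounded : ∀ e → Bounded D (_↓ D e)
  ↓-bounded e = e , λ _ x≤e → x≤e

  ↑-eventually : ∀ e → Eventually (_↑ D e)
  ↑-eventually e = e , λ _ e≤x → e≤x

  bounded-⊆ : {X Y : Pred Carrier 0ℓ} → X ⊆ Y → Bounded D Y → Bounded D X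
  bounded-⊆ X⊆Y (u , bound) = u , λ x Xx → bound x (X⊆Y Xx)

  cofinal-⊆ : {X Y : Pred Carrier 0ℓ} → X ⊆ Y → Cofinal D X → Cofinal D Y
  cofinal-⊆ X⊆Y cof e with cof e
  ... | x , Xx , e≤x = x , X⊆Y Xx , e≤x

  cofinal-∁⇒¬eventually : {P : Pred Carrier 0ℓ} → Cofinal D (∁ P) → ¬ Eventually P
  cofinal-∁⇒¬eventually cof (d , ev) with cof d
  ... | x , ¬Px , d≤x = ¬Px (ev x d≤x)

  ¬cofinal-∁⇒eventually : ExcludedMiddle → {P : Pred Carrier 0ℓ} →
                          ¬ Cofinal D (∁ P) → Eventually P
  ¬cofinal-∁⇒eventually lem ¬cof = ¬¬-elim lem λ ¬ev → ¬cof λ d →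
    ¬¬-elim lem λ ¬beyond → ¬ev (d , λ d' d≤d' →
      ¬¬-elim lem λ ¬Pd' → ¬beyond (d' , ¬Pd' , d≤d'))

module _ (D E : DirectedSet) (f : ∣ D ∣ → ∣ E ∣) where
  private
    module E = DirectedSet E

  tukey-preimage-bounded : ExcludedMiddle → IsTukey D E f →
                           {Y : Pred ∣ E ∣ 0ℓ} → Bounded E Y → Bounded D (f ⊢ Y)
  tukey-preimage-bounded lem tukey {Y} bdd = ¬¬-elim lem λ unbdd →
    tukey (f ⊢ Y) unbdd (bounded-⊆ E (image-preimage-⊆ f Y) bdd)

  convergent-preimage-eventually : ExcludedMiddle → IsConvergent D E f →
                                   {Y : Pred ∣ E ∣ 0ℓ} → Eventually E Y → Eventually D (f ⊢ Y)
  convergent-preimage-eventually lem conv {Y} ev = ¬cofinal-∁⇒eventually D lem λ cof →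
    cofinal-∁⇒¬eventually E (cofinal-⊆ E (image-preimage-⊆ f (∁ Y)) (conv _ cof)) ev

  πf-nonempty : ∀ d → Nonempty D E (πf D E f d)
  πf-nonempty d = f d , E.≤-refl

  πf-preTukey : (∀ e → Bounded D (f ⊢ _↓ E e)) → IsPreTukey D E (πf D E f)
  πf-preTukey bdd = πf-nonempty , λ e → let (u , bound) = bdd e in
    u , λ d' (e' , fd'≤e' , e'≤e) → bound d' (E.≤-trans fd'≤e' e'≤e)

  πf-preConvergent : (∀ e → Eventually D (f ⊢ _↑ E e)) → IsPreConvergent D E (πf D E f)
  πf-preConvergent ev = πf-nonempty , λ e → let (d , tail) = ev e in
    d , λ d' d≤d' fd'≤e' → E.≤-trans (tail d' d≤d') fd'≤e'

mainTheorem12 : ExcludedMiddle → (D E : DirectedSet) → (f : ∣ D ∣ → ∣ E ∣) →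
    (IsTukey D E f → IsPreTukey D E (πf D E f)) ×
    (IsConvergent D E f → IsPreConvergent D E (πf D E f))
mainTheorem12 lem D E f =
  (λ tukey → πf-preTukey D E f λ e →
     tukey-preimage-bounded D E f lem tukey (↓-bounded E e)) ,
  (λ conv → πf-preConvergent D E f λ e →
     convergent-preimage-eventually D E f lem conv (↑-eventually E e))
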